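{- Let $q$ be a power of a prime $p$, let $L\subseteq[q-1]$, and let $\mathcal{F}\subseteq 2^{[n]}$ be a $q$-modular $L$-differencing Sperner system. Suppose there is a polynomial $g\in\mathbb{Z}[y]$ of degree $d$ such that $v_p(g(0))<v_p(g(u))$ for every $u\in L+q\mathbb{Z}$. Then $$|\mathcal{F}|\le\sum_{i=0}^{d}\binom{n}{i}.$$ If in addition $v_p(g(0))\le v_p(g(u-1))$ for every $u\in L+q\mathbb{Z}$, or $v_p(g(0))\le v_p(g(u+1))$ for every $u\in L+q\mathbb{Z}$, then $$|\mathcal{F}|\le\sum_{i=0}^{d}\binom{n-1}{i}.$$
   Context: $n$ is a positive integer, $[n]=\{1,\ldots,n\}$, $[q-1]=\{1,\ldots,q-1\}$, $2^{[n]}$ is the family of all subsets of $[n]$, and $L+q\mathbb{Z}=\{\ell+qt:\ell\in L,t\in\mathbb{Z}\}$. For an integer $m$, $v_p(m)$ is the largest non-negative integer $k$ with $p^k\mid m$, and $v_p(0)=+\infty$. A family $\mathcal{F}\subseteq 2^{[n]}$ is $q$-modular $L$-differencing Sperner if for any distinct $A,B\in\mathcal{F}$ there is $\ell\in L$ with $|A\setminus B|\equiv\ell\pmod q$. -}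

module Defs where

open import Data.Nat as ℕ using (ℕ; zero; suc; _≤_; _<_; _∸_)
open import Data.Nat.Primality using (Prime)
open import Data.Nat.Combinatorics using (_C_)
open import Data.Integer as ℤ using (ℤ; +_)
open import Data.Integer.Divisibility using () renaming (_∣_ to _∣ℤ_)
open import Data.Fin using (Fin; fromℕ)
open import Data.Fin.Subset using (Subset; _─_; ∣_∣)
open import Data.Vec using (Vec; []; _∷_; lookup)
open import Data.List using (List)
open import Data.List.Membership.Propositional using (_∈_)
open import Data.List.Relation.Unary.All using (All)
open import Data.Product using (Σ; ∃; _×_; _,_)
open import Data.Empty using (⊥)
open import Data.Unit using (⊤)
open import Relation.Nullary using (¬_)
open import Relation.Binary.PropositionalEquality using (_≡_; _≢_)

IsPrimePowerOf : ℕ → ℕ → Set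
IsPrimePowerOf q p = Prime p × Σ ℕ (λ k → 1 ≤ k × q ≡ p ℕ.^ k)

SubsetOfInit : List ℕ → ℕ → Set
SubsetOfInit L q = All (λ ℓ → 1 ≤ ℓ × ℓ ≤ q ∸ 1) L

_≡_[mod_] : ℤ → ℤ → ℕ → Set
a ≡ b [mod q ] = Σ ℤ (λ t → a ≡ b ℤ.+ (+ q) ℤ.* t)

DiffSperner : (n q : ℕ) → List ℕ → List (Subset n) → Set
DiffSperner n q L F =
  ∀ {A B} → A ∈ F → B ∈ F → A ≢ B →
  Σ ℕ (λ ℓ → ℓ ∈ L × (+ ∣ A ─ B ∣) ≡ (+ ℓ) [mod q ])

InShift : List ℕ → ℕ → ℤ → Set
InShift L q u = Σ ℕ (λ ℓ → ℓ ∈ L × Σ ℤ (λ t → u ≡ (+ ℓ) ℤ.+ (+ q) ℤ.* t))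

-- integer polynomials: coefficient vector c₀, …, c_d (c_i is the coefficient of y^i)
-- evaluation (Horner)
eval : ∀ {m} → Vec ℤ m → ℤ → ℤ
eval [] y = + 0
eval (c ∷ cs) y = c ℤ.+ y ℤ.* eval cs y

HasDegree : ∀ d → Vec ℤ (suc d) → Set
HasDegree d g = lookup g (fromℕ d) ≢ + 0

-- extended naturals for p-adic valuations (v_p(0) = +∞)
data ℕ∞ : Set where
  fin : ℕ → ℕ∞
  ∞   : ℕ∞

_<∞_ : ℕ∞ → ℕ∞ → Set
fin a <∞ fin b = a < b
fin a <∞ ∞     = ⊤
∞     <∞ _     = ⊥

_≤∞_ : ℕ∞ → ℕ∞ → Set
fin a ≤∞ fin b = a ≤ b
fin a ≤∞ ∞     = ⊤
∞     ≤∞ fin _ = ⊥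
∞     ≤∞ ∞     = ⊤

IsVal : ℕ → ℤ → ℕ∞ → Set
IsVal p m (fin k) = (+ (p ℕ.^ k)) ∣ℤ m × ¬ ((+ (p ℕ.^ suc k)) ∣ℤ m)
IsVal p m ∞ = m ≡ + 0

VLt : ℕ → ℤ → ℤ → Set
VLt p a b = ∀ v w → IsVal p a v → IsVal p b w → v <∞ w

VLe : ℕ → ℤ → ℤ → Set
VLe p a b = ∀ v w → IsVal p a v → IsVal p b w → v ≤∞ w

binomSum : ℕ → ℕ → ℕ
binomSum n zero = n C 0
binomSum n (suc d) = binomSum n d ℕ.+ n C suc d

{-# OPTIONS --safe #-}
-- Write n = m + 1 and A = b ∷ A′ for A ∈ F, where b says whether the first point
-- lies in A. The test function G_A(x) = g(|A′ ─ x|) if b is false and g(|x ─ A′|)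
-- if b is true is a polynomial of degree ≤ d in x ∈ {0,1}^m, so the G_A lie in a
-- ℤ-module of rank Σ_{i≤d} C(m,i). At x = B′ it takes the value g(|A ─ B|) or
-- g(|B ─ A|), both in g(L + qℤ) for A ≠ B, and g(0) for A = B. Hence the matrix
-- (G_A(B′)) is p-adically dominated by its diagonal: in an integer relation among
-- the G_A, the coefficient of least p-adic valuation cannot be cancelled. So the
-- G_A are independent and |F| ≤ Σ_{i≤d} C(n-1,i); this needs only the first hypothesis.
module Submission where

open import Defs
open import Data.Nat as ℕ using (ℕ; zero; suc; _≤_; _<_; _∸_; _^_; s≤s; NonZero)
import Data.Nat.Properties as ℕP
import Data.Nat.Tactic.RingSolver as ℕS
open import Data.Nat.Combinatorics using (_C_; nCk+nC[k+1]≡[n+1]C[k+1])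
open import Data.Nat.Divisibility as ℕ∣
  using (_∣_; divides-refl; _∣?_; 1∣_; ∣⇒≤; *-pres-∣; ∣-trans; *-cancelˡ-∣)
open import Data.Nat.Primality using (Prime; prime⇒nonZero; prime⇒nonTrivial; euclidsLemma)
open import Data.Integer as ℤ using (ℤ; +_; _+_; _*_; -_; _-_; ∣_∣)
import Data.Integer.Properties as ℤP
import Data.Integer.Divisibility.Signed as ℤ∣
open import Data.Integer.Tactic.RingSolver using (solve-∀)
open import Algebra.Properties.Semiring.Sum ℤP.+-*-semiring
  using (sum; ∑-distrib-+; *-distribˡ-sum; sum-remove; sum-replicate-zero; sum-cong-≗)
open import Data.Bool using (Bool; true; false)
open import Data.Fin using (Fin; zero; suc; punchIn)
open import Data.Fin.Properties using (all?; ¬∀⟶∃¬; punchInᵢ≢i)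
open import Data.Fin.Subset as Subset using (Subset; _─_)
open import Data.Vec using (Vec; []; _∷_; tail)
open import Data.Vec.Functional using (Vector; insertAt; removeAt; _++_; take; drop)
open import Data.Vec.Functional.Properties using (insertAt-lookup; insertAt-punchIn; lookup-++ˡ; lookup-++ʳ)
open import Data.List as List using (List; []; _∷_; length)
open import Data.List.Membership.Propositional.Properties using (∈-lookup)
import Data.List.Relation.Unary.All as All
open import Data.List.Relation.Unary.AllPairs using (_∷_)
open import Data.List.Relation.Unary.Unique.Propositional using (Unique)
open import Data.Product using (Σ; ∃; _×_; _,_; proj₁; proj₂)
open import Data.Sum using (_⊎_; inj₁; inj₂)
open import Function using (_∘_; const)
open import Relation.Nullary using (¬_; yes; no; contradiction)
open import Relation.Binary.PropositionalEquality

Nontrivial : ∀ {m} → Vector ℤ m → Set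
Nontrivial c = ∃ λ i → c i ≢ + 0

IsRelation : ∀ {m N} → (Fin m → Vector ℤ N) → Vector ℤ m → Set
IsRelation v c = ∀ k → sum (λ i → c i * v i k) ≡ + 0

sum-zero : ∀ {m} (f : Vector ℤ m) → (∀ i → f i ≡ + 0) → sum f ≡ + 0
sum-zero {m} f f≡0 = trans (sum-cong-≗ f≡0) (sum-replicate-zero m)

sum-*-+ : ∀ {m} (c x y : Vector ℤ m) a b →
  sum (λ i → c i * (a * x i + b * y i)) ≡ a * sum (λ i → c i * x i) + b * sum (λ i → c i * y i)
sum-*-+ c x y a b = begin
  sum (λ i → c i * (a * x i + b * y i))
    ≡⟨ sum-cong-≗ (λ i → distribute a b (c i) (x i) (y i)) ⟩
  sum (λ i → a * (c i * x i) + b * (c i * y i))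
    ≡⟨ ∑-distrib-+ (λ i → a * (c i * x i)) (λ i → b * (c i * y i)) ⟩
  sum (λ i → a * (c i * x i)) + sum (λ i → b * (c i * y i))
    ≡⟨ sym (cong₂ _+_ (*-distribˡ-sum a (λ i → c i * x i)) (*-distribˡ-sum b (λ i → c i * y i))) ⟩
  a * sum (λ i → c i * x i) + b * sum (λ i → c i * y i) ∎
  where
  open ≡-Reasoning
  distribute : ∀ a b c x y → c * (a * x + b * y) ≡ a * (c * x) + b * (c * y)
  distribute = solve-∀

∣-sum : ∀ {M} d (f : Vector ℤ M) → (∀ i → d ℤ∣.∣ f i) → d ℤ∣.∣ sum f
∣-sum {zero}  d f d∣f = ℤ∣.∣ᵤ⇒∣ (ℕ∣._∣0 _)
∣-sum {suc M} d f d∣f = ℤ∣.∣m∣n⇒∣m+n (d∣f zero) (∣-sum d (f ∘ suc) (d∣f ∘ suc))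

integerRelation : ∀ {N m} → N < m → (v : Fin m → Vector ℤ N) →
  ∃ λ c → Nontrivial c × IsRelation v c
integerRelation {zero} {suc m} _ v = (λ _ → + 1) , (zero , λ ()) , λ ()
integerRelation {suc N} {suc m} (s≤s N<m) v with all? (λ i → v i zero ℤP.≟ + 0)
... | yes first≡0 = c , c≢0 , relation
  where
  sub = integerRelation (ℕP.m<n⇒m<1+n N<m) (λ i k → v i (suc k))
  c = proj₁ sub
  c≢0 = proj₁ (proj₂ sub)
  relation : IsRelation v c
  relation zero = sum-zero _ (λ i → trans (cong (c i *_) (first≡0 i)) (ℤP.*-zeroʳ (c i)))
  relation (suc k) = proj₂ (proj₂ sub) k
... | no ¬first≡0 = c , (punchIn j i₀ , c≢0) , relation
  where
  pivot = ¬∀⟶∃¬ (suc m) _ (λ i → v i zero ℤP.≟ + 0) ¬first≡0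
  j = proj₁ pivot
  a = v j zero
  -- a relation c′ among the rows a · v i − v i 0 · v j (i ≠ j) lifts to the rows v i
  rest : Fin m → Vector ℤ (suc N)
  rest = removeAt v j
  w : Fin m → Vector ℤ N
  w i k = a * rest i (suc k) + (- v j (suc k)) * rest i zero
  sub = integerRelation N<m w
  c′ = proj₁ sub
  i₀ = proj₁ (proj₁ (proj₂ sub))
  S = sum (λ i → c′ i * rest i zero)
  c : Vector ℤ (suc m)
  c = insertAt (λ i → a * c′ i) j (- S)
  c≢0 : c (punchIn j i₀) ≢ + 0
  c≢0 ≡0 with ℤP.i*j≡0⇒i≡0∨j≡0 a (trans (sym (insertAt-punchIn _ j _ i₀)) ≡0)
  ... | inj₁ a≡0 = proj₂ pivot a≡0
  ... | inj₂ c′≡0 = proj₂ (proj₁ (proj₂ sub)) c′≡0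
  eliminate : ∀ k → sum (λ x → c x * v x k) ≡ (- S) * v j k + a * sum (λ i → c′ i * rest i k)
  eliminate k = begin
    sum (λ x → c x * v x k)
      ≡⟨ sum-remove {i = j} (λ x → c x * v x k) ⟩
    c j * v j k + sum (λ i → c (punchIn j i) * rest i k)
      ≡⟨ cong₂ _+_ (cong (_* v j k) (insertAt-lookup _ j _))
                   (sum-cong-≗ λ i → trans (cong (_* rest i k) (insertAt-punchIn _ j _ i))
                                           (ℤP.*-assoc a (c′ i) (rest i k))) ⟩
    (- S) * v j k + sum (λ i → a * (c′ i * rest i k))
      ≡⟨ cong (λ t → (- S) * v j k + t) (sym (*-distribˡ-sum a (λ i → c′ i * rest i k))) ⟩
    (- S) * v j k + a * sum (λ i → c′ i * rest i k) ∎
    where open ≡-Reasoning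
  cancel : ∀ s a → (- s) * a + a * s ≡ + 0
  cancel = solve-∀
  swap : ∀ s b a t → (- s) * b + a * t ≡ a * t + (- b) * s
  swap = solve-∀
  relation : IsRelation v c
  relation zero = trans (eliminate zero) (cancel S a)
  relation (suc k) = begin
    sum (λ x → c x * v x (suc k))
      ≡⟨ eliminate (suc k) ⟩
    (- S) * v j (suc k) + a * sum (λ i → c′ i * rest i (suc k))
      ≡⟨ swap S (v j (suc k)) a _ ⟩
    a * sum (λ i → c′ i * rest i (suc k)) + (- v j (suc k)) * S
      ≡⟨ sym (sum-*-+ c′ _ _ a (- v j (suc k))) ⟩
    sum (λ i → c′ i * w i k)
      ≡⟨ proj₂ (proj₂ sub) k ⟩
    + 0 ∎
    where open ≡-Reasoning

-- A function of degree < k on {0,1}^(1+n) is stored as f (x₀ ∷ x) = f⁰ x + x₀ · f¹ x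
-- with deg f⁰ < k and deg f¹ < k − 1, the coefficients of f⁰ first.
dim : ℕ → ℕ → ℕ
dim n       zero    = 0
dim zero    (suc k) = 1
dim (suc n) (suc k) = dim n (suc k) ℕ.+ dim n k

record Coeffs (n k : ℕ) : Set where
  constructor coeffs
  field coeff : Vector ℤ (dim n k)

open Coeffs

coeffs⁰ : ∀ {n k} → Coeffs (suc n) (suc k) → Coeffs n (suc k)
coeffs⁰ {n} {k} c = coeffs (take (dim n (suc k)) (coeff c))

coeffs¹ : ∀ {n k} → Coeffs (suc n) (suc k) → Coeffs n k
coeffs¹ {n} {k} c = coeffs (drop (dim n (suc k)) (coeff c))

⟦_⟧ : ∀ {n k} → Coeffs n k → Vec Bool n → ℤ
⟦_⟧ {k = zero}          c x           = + 0
⟦_⟧ {zero}  {suc k}     c []          = coeff c zero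
⟦_⟧ {suc n} {suc k}     c (false ∷ x) = ⟦ coeffs⁰ c ⟧ x
⟦_⟧ {suc n} {suc k}     c (true  ∷ x) = ⟦ coeffs⁰ c ⟧ x + ⟦ coeffs¹ c ⟧ x

⟦⟧-cong : ∀ {n k} (c d : Coeffs n k) → (∀ i → coeff c i ≡ coeff d i) → ⟦ c ⟧ ≗ ⟦ d ⟧
⟦⟧-cong {k = zero}      c d c≗d x           = refl
⟦⟧-cong {zero}  {suc k} c d c≗d []          = c≗d zero
⟦⟧-cong {suc n} {suc k} c d c≗d (false ∷ x) = ⟦⟧-cong (coeffs⁰ c) (coeffs⁰ d) (λ i → c≗d _) x
⟦⟧-cong {suc n} {suc k} c d c≗d (true ∷ x)  =
  cong₂ _+_ (⟦⟧-cong (coeffs⁰ c) (coeffs⁰ d) (λ i → c≗d _) x)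
            (⟦⟧-cong (coeffs¹ c) (coeffs¹ d) (λ i → c≗d _) x)

0ᶜ : ∀ {n k} → Coeffs n k
0ᶜ = coeffs (const (+ 0))

infixl 6 _+ᶜ_
infixl 7 _·ᶜ_

_+ᶜ_ : ∀ {n k} → Coeffs n k → Coeffs n k → Coeffs n k
c +ᶜ d = coeffs (λ i → coeff c i + coeff d i)

_·ᶜ_ : ∀ {n k} → ℤ → Coeffs n k → Coeffs n k
a ·ᶜ c = coeffs (λ i → a * coeff c i)

⟦0ᶜ⟧ : ∀ {n k} x → ⟦ 0ᶜ {n} {k} ⟧ x ≡ + 0
⟦0ᶜ⟧ {k = zero}         x           = refl
⟦0ᶜ⟧ {zero}  {suc k}    []          = refl
⟦0ᶜ⟧ {suc n} {suc k}    (false ∷ x) = ⟦0ᶜ⟧ {n} {suc k} x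
⟦0ᶜ⟧ {suc n} {suc k}    (true ∷ x)  = cong₂ _+_ (⟦0ᶜ⟧ {n} {suc k} x) (⟦0ᶜ⟧ {n} {k} x)

⟦+ᶜ⟧ : ∀ {n k} (c d : Coeffs n k) x → ⟦ c +ᶜ d ⟧ x ≡ ⟦ c ⟧ x + ⟦ d ⟧ x
⟦+ᶜ⟧ {k = zero}      c d x           = refl
⟦+ᶜ⟧ {zero}  {suc k} c d []          = refl
⟦+ᶜ⟧ {suc n} {suc k} c d (false ∷ x) = ⟦+ᶜ⟧ (coeffs⁰ c) (coeffs⁰ d) x
⟦+ᶜ⟧ {suc n} {suc k} c d (true ∷ x)  = begin
  ⟦ coeffs⁰ (c +ᶜ d) ⟧ x + ⟦ coeffs¹ (c +ᶜ d) ⟧ x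
    ≡⟨ cong₂ _+_ (⟦+ᶜ⟧ (coeffs⁰ c) (coeffs⁰ d) x) (⟦+ᶜ⟧ (coeffs¹ c) (coeffs¹ d) x) ⟩
  (⟦ coeffs⁰ c ⟧ x + ⟦ coeffs⁰ d ⟧ x) + (⟦ coeffs¹ c ⟧ x + ⟦ coeffs¹ d ⟧ x)
    ≡⟨ interchange (⟦ coeffs⁰ c ⟧ x) (⟦ coeffs⁰ d ⟧ x) (⟦ coeffs¹ c ⟧ x) (⟦ coeffs¹ d ⟧ x) ⟩
  (⟦ coeffs⁰ c ⟧ x + ⟦ coeffs¹ c ⟧ x) + (⟦ coeffs⁰ d ⟧ x + ⟦ coeffs¹ d ⟧ x) ∎
  where
  open ≡-Reasoning
  interchange : ∀ a b e f → (a + b) + (e + f) ≡ (a + e) + (b + f)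
  interchange = solve-∀

⟦·ᶜ⟧ : ∀ {n k} a (c : Coeffs n k) x → ⟦ a ·ᶜ c ⟧ x ≡ a * ⟦ c ⟧ x
⟦·ᶜ⟧ {k = zero}      a c x           = sym (ℤP.*-zeroʳ a)
⟦·ᶜ⟧ {zero}  {suc k} a c []          = refl
⟦·ᶜ⟧ {suc n} {suc k} a c (false ∷ x) = ⟦·ᶜ⟧ a (coeffs⁰ c) x
⟦·ᶜ⟧ {suc n} {suc k} a c (true ∷ x)  =
  trans (cong₂ _+_ (⟦·ᶜ⟧ a (coeffs⁰ c) x) (⟦·ᶜ⟧ a (coeffs¹ c) x))
        (sym (ℤP.*-distribˡ-+ a (⟦ coeffs⁰ c ⟧ x) (⟦ coeffs¹ c ⟧ x)))

linearCombination : ∀ {M n k} → Vector ℤ M → (Fin M → Coeffs n k) → Coeffs n k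
linearCombination a c = coeffs (λ j → sum (λ i → a i * coeff (c i) j))

⟦linearCombination⟧ : ∀ {M n k} (a : Vector ℤ M) (c : Fin M → Coeffs n k) x →
  ⟦ linearCombination a c ⟧ x ≡ sum (λ i → a i * ⟦ c i ⟧ x)
⟦linearCombination⟧ {zero} {n} {k} a c x = ⟦0ᶜ⟧ {n} {k} x
⟦linearCombination⟧ {suc M} a c x = begin
  ⟦ a zero ·ᶜ c zero +ᶜ linearCombination (a ∘ suc) (c ∘ suc) ⟧ x
    ≡⟨ ⟦+ᶜ⟧ (a zero ·ᶜ c zero) _ x ⟩
  ⟦ a zero ·ᶜ c zero ⟧ x + ⟦ linearCombination (a ∘ suc) (c ∘ suc) ⟧ x
    ≡⟨ cong₂ _+_ (⟦·ᶜ⟧ (a zero) (c zero) x) (⟦linearCombination⟧ (a ∘ suc) (c ∘ suc) x) ⟩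
  a zero * ⟦ c zero ⟧ x + sum (λ i → a (suc i) * ⟦ c (suc i) ⟧ x) ∎
  where open ≡-Reasoning

DegreeBelow : ∀ {n} → ℕ → (Vec Bool n → ℤ) → Set
DegreeBelow {n} k φ = Σ (Coeffs n k) λ c → ⟦ c ⟧ ≗ φ

module _ {n k : ℕ} where

  degreeBelow-⟦⟧ : (c : Coeffs n k) → DegreeBelow k ⟦ c ⟧
  degreeBelow-⟦⟧ c = c , λ _ → refl

  degreeBelow-resp : ∀ {φ ψ : Vec Bool n → ℤ} → φ ≗ ψ → DegreeBelow k φ → DegreeBelow k ψ
  degreeBelow-resp φ≗ψ (c , ⟦c⟧≗φ) = c , λ x → trans (⟦c⟧≗φ x) (φ≗ψ x)

  degreeBelow-zero : DegreeBelow k (const (+ 0))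
  degreeBelow-zero = 0ᶜ , ⟦0ᶜ⟧ {n} {k}

  degreeBelow-+ : ∀ {φ ψ : Vec Bool n → ℤ} →
    DegreeBelow k φ → DegreeBelow k ψ → DegreeBelow k (λ x → φ x + ψ x)
  degreeBelow-+ (c , ⟦c⟧≗φ) (d , ⟦d⟧≗ψ) =
    c +ᶜ d , λ x → trans (⟦+ᶜ⟧ c d x) (cong₂ _+_ (⟦c⟧≗φ x) (⟦d⟧≗ψ x))

  degreeBelow-scale : ∀ {φ : Vec Bool n → ℤ} a → DegreeBelow k φ → DegreeBelow k (λ x → a * φ x)
  degreeBelow-scale a (c , ⟦c⟧≗φ) =
    a ·ᶜ c , λ x → trans (⟦·ᶜ⟧ a c x) (cong (a *_) (⟦c⟧≗φ x))

degreeBelow-nullary : ∀ {k} (φ : Vec Bool 0 → ℤ) → DegreeBelow (suc k) φ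
degreeBelow-nullary φ = coeffs (λ _ → φ []) , λ { [] → refl }

degreeBelow-extend : ∀ {n k φ₀ φ₁} (φ : Vec Bool (suc n) → ℤ) →
  DegreeBelow (suc k) φ₀ → DegreeBelow k φ₁ →
  (∀ x → φ (false ∷ x) ≡ φ₀ x) → (∀ x → φ (true ∷ x) ≡ φ₀ x + φ₁ x) →
  DegreeBelow (suc k) φ
degreeBelow-extend {n} {k} φ (c₀ , ⟦c₀⟧≗φ₀) (c₁ , ⟦c₁⟧≗φ₁) φ-false φ-true = c , ⟦c⟧≗φ
  where
  c : Coeffs (suc n) (suc k)
  c = coeffs (coeff c₀ ++ coeff c₁)
  ⟦c⟧≗φ : ⟦ c ⟧ ≗ φ
  ⟦c⟧≗φ (false ∷ x) = begin
    ⟦ coeffs⁰ c ⟧ x ≡⟨ ⟦⟧-cong (coeffs⁰ c) c₀ (lookup-++ˡ (coeff c₀) (coeff c₁)) x ⟩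
    ⟦ c₀ ⟧ x        ≡⟨ ⟦c₀⟧≗φ₀ x ⟩
    _               ≡⟨ φ-false x ⟨
    φ (false ∷ x)   ∎
    where open ≡-Reasoning
  ⟦c⟧≗φ (true ∷ x) = begin
    ⟦ coeffs⁰ c ⟧ x + ⟦ coeffs¹ c ⟧ x
      ≡⟨ cong₂ _+_ (⟦⟧-cong (coeffs⁰ c) c₀ (lookup-++ˡ (coeff c₀) (coeff c₁)) x)
                   (⟦⟧-cong (coeffs¹ c) c₁ (lookup-++ʳ (coeff c₀) (coeff c₁)) x) ⟩
    ⟦ c₀ ⟧ x + ⟦ c₁ ⟧ x
      ≡⟨ cong₂ _+_ (⟦c₀⟧≗φ₀ x) (⟦c₁⟧≗φ₁ x) ⟩
    _ ≡⟨ φ-true x ⟨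
    φ (true ∷ x) ∎
    where open ≡-Reasoning

degreeBelow-suc : ∀ {n k} {φ : Vec Bool n → ℤ} → DegreeBelow k φ → DegreeBelow (suc k) φ
degreeBelow-suc {n} {k} (c , ⟦c⟧≗φ) = degreeBelow-resp ⟦c⟧≗φ (go c)
  where
  go : ∀ {n k} (c : Coeffs n k) → DegreeBelow (suc k) ⟦ c ⟧
  go {k = zero}      c = degreeBelow-zero
  go {zero}  {suc k} c = degreeBelow-nullary ⟦ c ⟧
  go {suc n} {suc k} c =
    degreeBelow-extend ⟦ c ⟧ (go (coeffs⁰ c)) (go (coeffs¹ c)) (λ _ → refl) (λ _ → refl)

degreeBelow-const : ∀ {n k} a → DegreeBelow {n} (suc k) (const a)
degreeBelow-const {zero}  a = degreeBelow-nullary (const a)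
degreeBelow-const {suc n} a =
  degreeBelow-extend (const a) (degreeBelow-const a) degreeBelow-zero
    (λ _ → refl) (λ _ → sym (ℤP.+-identityʳ a))

-- x ↦ Σᵢ hᵢ(xᵢ); every affine function on {0,1}^n has this form.
Affine : ℕ → Set
Affine n = Vec (Bool → ℤ) n

⟦_⟧ₐ : ∀ {n} → Affine n → Vec Bool n → ℤ
⟦ []     ⟧ₐ []      = + 0
⟦ h ∷ hs ⟧ₐ (b ∷ x) = h b + ⟦ hs ⟧ₐ x

degreeBelow-affine* : ∀ {n k} (hs : Affine n) {φ : Vec Bool n → ℤ} →
  DegreeBelow k φ → DegreeBelow (suc k) (λ x → ⟦ hs ⟧ₐ x * φ x)
degreeBelow-affine* hs (c , ⟦c⟧≗φ) =
  degreeBelow-resp (λ x → cong (⟦ hs ⟧ₐ x *_) (⟦c⟧≗φ x)) (go hs c)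
  where
  go : ∀ {n k} (hs : Affine n) (c : Coeffs n k) → DegreeBelow (suc k) (λ x → ⟦ hs ⟧ₐ x * ⟦ c ⟧ x)
  go {k = zero}      hs c = degreeBelow-resp (λ x → sym (ℤP.*-zeroʳ (⟦ hs ⟧ₐ x))) degreeBelow-zero
  go {zero}  {suc k} [] c = degreeBelow-nullary _
  go {suc n} {suc k} (h ∷ hs) c = degreeBelow-extend _ at-false at-true
    (λ x → ℤP.*-distribʳ-+ (φ₀ x) (h false) (⟦ hs ⟧ₐ x))
    (λ x → expand (h false) (h true) (⟦ hs ⟧ₐ x) (φ₀ x) (φ₁ x))
    where
    φ₀ = ⟦ coeffs⁰ c ⟧
    φ₁ = ⟦ coeffs¹ c ⟧
    at-false : DegreeBelow (suc (suc k)) (λ x → h false * φ₀ x + ⟦ hs ⟧ₐ x * φ₀ x)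
    at-false = degreeBelow-+ (degreeBelow-suc (degreeBelow-scale (h false) (degreeBelow-⟦⟧ (coeffs⁰ c))))
                             (go hs (coeffs⁰ c))
    at-true : DegreeBelow (suc k) (λ x → (h true - h false) * φ₀ x + h true * φ₁ x + ⟦ hs ⟧ₐ x * φ₁ x)
    at-true = degreeBelow-+
      (degreeBelow-+ (degreeBelow-scale (h true - h false) (degreeBelow-⟦⟧ (coeffs⁰ c)))
                     (degreeBelow-suc (degreeBelow-scale (h true) (degreeBelow-⟦⟧ (coeffs¹ c)))))
      (go hs (coeffs¹ c))
    expand : ∀ f t l a b → (t + l) * (a + b) ≡ (f * a + l * a) + ((t - f) * a + t * b + l * b)
    expand = solve-∀

degreeBelow-polynomial∘affine : ∀ {n m} (g : Vec ℤ m) (hs : Affine n) →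
  DegreeBelow m (λ x → eval g (⟦ hs ⟧ₐ x))
degreeBelow-polynomial∘affine []       hs = degreeBelow-zero
degreeBelow-polynomial∘affine (c ∷ cs) hs =
  degreeBelow-+ (degreeBelow-const c) (degreeBelow-affine* hs (degreeBelow-polynomial∘affine cs hs))

binomSum-pascal : ∀ n d → binomSum (suc n) (suc d) ≡ binomSum n (suc d) ℕ.+ binomSum n d
binomSum-pascal n zero = begin
  1 ℕ.+ suc n C 1             ≡⟨ cong suc (nCk+nC[k+1]≡[n+1]C[k+1] n 0) ⟨
  1 ℕ.+ (1 ℕ.+ n C 1)         ≡⟨ ℕP.+-comm 1 (1 ℕ.+ n C 1) ⟩
  1 ℕ.+ n C 1 ℕ.+ 1           ∎
  where open ≡-Reasoning
binomSum-pascal n (suc d) = begin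
  binomSum (suc n) (suc d) ℕ.+ suc n C suc (suc d)
    ≡⟨ cong₂ ℕ._+_ (binomSum-pascal n d) (sym (nCk+nC[k+1]≡[n+1]C[k+1] n (suc d))) ⟩
  (binomSum n (suc d) ℕ.+ binomSum n d) ℕ.+ (n C suc d ℕ.+ n C suc (suc d))
    ≡⟨ rearrange (binomSum n (suc d)) (binomSum n d) (n C suc d) (n C suc (suc d)) ⟩
  (binomSum n (suc d) ℕ.+ n C suc (suc d)) ℕ.+ (binomSum n d ℕ.+ n C suc d) ∎
  where
  open ≡-Reasoning
  rearrange : ∀ a b c e → (a ℕ.+ b) ℕ.+ (c ℕ.+ e) ≡ (a ℕ.+ e) ℕ.+ (b ℕ.+ c)
  rearrange = ℕS.solve-∀

dim≡binomSum : ∀ n d → dim n (suc d) ≡ binomSum n d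
dim≡binomSum zero    zero    = refl
dim≡binomSum zero    (suc d) = trans (dim≡binomSum zero d) (sym (ℕP.+-identityʳ _))
dim≡binomSum (suc n) zero    = trans (ℕP.+-identityʳ (dim n 1)) (dim≡binomSum n 0)
dim≡binomSum (suc n) (suc d) =
  trans (cong₂ ℕ._+_ (dim≡binomSum n (suc d)) (dim≡binomSum n d)) (sym (binomSum-pascal n d))

binomSum-mono : ∀ n d → binomSum n d ≤ binomSum (suc n) d
binomSum-mono n zero    = ℕP.≤-refl
binomSum-mono n (suc d) = subst (binomSum n (suc d) ≤_) (sym (binomSum-pascal n d)) (ℕP.m≤m+n _ _)

module _ {p : ℕ} (p-prime : Prime p) where

  instance
    p≢0 : NonZero p
    p≢0 = prime⇒nonZero p-prime

  1<p : 1 < p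
  1<p = ℕ.nonTrivial⇒n>1 p {{prime⇒nonTrivial p-prime}}

  n<p^n : ∀ n → n < p ^ n
  n<p^n zero    = ℕP.n<1+n 0
  n<p^n (suc n) = ℕP.≤-<-trans (n<p^n n) (ℕP.^-monoʳ-< p 1<p (ℕP.n<1+n n))

  p^m∣p^n : ∀ {m n} → m ≤ n → p ^ m ∣ p ^ n
  p^m∣p^n {m} {n} m≤n = ℕ∣.divides (p ^ (n ℕ.∸ m)) (begin
    p ^ n                   ≡⟨ cong (p ^_) (ℕP.m+[n∸m]≡n m≤n) ⟨
    p ^ (m ℕ.+ (n ℕ.∸ m))   ≡⟨ ℕP.^-distribˡ-+-* p m (n ℕ.∸ m) ⟩
    p ^ m ℕ.* p ^ (n ℕ.∸ m) ≡⟨ ℕP.*-comm (p ^ m) _ ⟩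
    p ^ (n ℕ.∸ m) ℕ.* p ^ m ∎)
    where open ≡-Reasoning

  ¬p^∣z∣∣z : ∀ z → z ≢ + 0 → ¬ p ^ ∣ z ∣ ∣ ∣ z ∣
  ¬p^∣z∣∣z (+ zero)     z≢0 _   = z≢0 refl
  ¬p^∣z∣∣z (+ suc n)    z≢0 p^z∣z = ℕP.<⇒≱ (n<p^n (suc n)) (∣⇒≤ p^z∣z)
  ¬p^∣z∣∣z ℤ.-[1+ n ]   z≢0 p^z∣z = ℕP.<⇒≱ (n<p^n (suc n)) (∣⇒≤ p^z∣z)

  IsMinValuation : ∀ {M} → Vector ℤ M → ℕ → Set
  IsMinValuation c a = (∀ i → p ^ a ∣ ∣ c i ∣) × ∃ λ j → ¬ p ^ suc a ∣ ∣ c j ∣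

  minValuation-below : ∀ {M} (c : Vector ℤ M) b →
    (∃ λ j → ¬ p ^ b ∣ ∣ c j ∣) → ∃ (IsMinValuation c)
  minValuation-below c zero    (j , ¬p^0∣cj) = contradiction (1∣ ∣ c j ∣) ¬p^0∣cj
  minValuation-below {M} c (suc b) ¬p^[1+b]∣c with all? (λ i → p ^ b ∣? ∣ c i ∣)
  ... | yes p^b∣c  = b , p^b∣c , ¬p^[1+b]∣c
  ... | no ¬p^b∣c = minValuation-below c b (¬∀⟶∃¬ M _ (λ i → p ^ b ∣? ∣ c i ∣) ¬p^b∣c)

  minValuation : ∀ {M} (c : Vector ℤ M) → Nontrivial c → ∃ (IsMinValuation c)
  minValuation c (i , ci≢0) = minValuation-below c ∣ c i ∣ (i , ¬p^∣z∣∣z (c i) ci≢0)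

  finiteValuation : ∀ {x} → x ≢ + 0 → ∃ λ e → IsVal p x (fin e)
  finiteValuation {x} x≢0 with minValuation {1} (const x) (zero , x≢0)
  ... | a , p^a∣x , _ , ¬p^[1+a]∣x = a , p^a∣x zero , ¬p^[1+a]∣x

  valuation : ∀ z → ∃ (IsVal p z)
  valuation z with z ℤP.≟ + 0
  ... | yes z≡0 = ∞ , z≡0
  ... | no z≢0 = fin (proj₁ (finiteValuation z≢0)) , proj₂ (finiteValuation z≢0)

  exactPowers-* : ∀ {a e m n} → p ^ a ∣ m → ¬ p ^ suc a ∣ m → p ^ e ∣ n → ¬ p ^ suc e ∣ n →
                  ¬ p ^ (a ℕ.+ suc e) ∣ m ℕ.* n
  exactPowers-* {a} {e} (divides-refl q) ¬p^[1+a]∣m (divides-refl r) ¬p^[1+e]∣n p^[a+1+e]∣mn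
    with euclidsLemma q r p-prime (*-cancelˡ-∣ (p ^ (a ℕ.+ e)) {{ℕP.m^n≢0 p (a ℕ.+ e)}}
                                     (subst₂ _∣_ p^[a+1+e]≡ mn≡ p^[a+1+e]∣mn))
    where
    p^[a+1+e]≡ : p ^ (a ℕ.+ suc e) ≡ p ^ (a ℕ.+ e) ℕ.* p
    p^[a+1+e]≡ = trans (cong (p ^_) (ℕP.+-suc a e)) (ℕP.*-comm p (p ^ (a ℕ.+ e)))
    shuffle : ∀ q x r y → q ℕ.* x ℕ.* (r ℕ.* y) ≡ x ℕ.* y ℕ.* (q ℕ.* r)
    shuffle = ℕS.solve-∀
    mn≡ : q ℕ.* p ^ a ℕ.* (r ℕ.* p ^ e) ≡ p ^ (a ℕ.+ e) ℕ.* (q ℕ.* r)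
    mn≡ = trans (shuffle q (p ^ a) r (p ^ e)) (cong (ℕ._* (q ℕ.* r)) (sym (ℕP.^-distribˡ-+-* p a e)))
  ... | inj₁ p∣q = ¬p^[1+a]∣m (*-pres-∣ p∣q (ℕ∣.∣-refl {p ^ a}))
  ... | inj₂ p∣r = ¬p^[1+e]∣n (*-pres-∣ p∣r (ℕ∣.∣-refl {p ^ e}))

  VLt⇒p^[1+e]∣ : ∀ {x y e} → IsVal p x (fin e) → VLt p x y → p ^ suc e ∣ ∣ y ∣
  VLt⇒p^[1+e]∣ {y = y} {e} x-val x<y with valuation y
  ... | ∞ , refl = ℕ∣._∣0 _
  ... | fin w , y-val = ∣-trans (p^m∣p^n (x<y (fin e) (fin w) x-val y-val)) (proj₁ y-val)

  diagonal⇒noRelation : ∀ {M e g₀} (V : Fin M → Vector ℤ M) → IsVal p g₀ (fin e) →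
    (∀ j → V j j ≡ g₀) → (∀ i j → i ≢ j → p ^ suc e ∣ ∣ V i j ∣) →
    (c : Vector ℤ M) → Nontrivial c → ¬ IsRelation V c
  diagonal⇒noRelation {suc M} {e} {g₀} V g₀-val diagonal offDiagonal c c≢0 relation
    with minValuation c c≢0
  ... | a , p^a∣c , j , ¬p^[1+a]∣cj =
    exactPowers-* {a} {e} (p^a∣c j) ¬p^[1+a]∣cj (proj₁ g₀-val) (proj₂ g₀-val) p^[a+1+e]∣cj*g₀
    where
    d = + (p ^ (a ℕ.+ suc e))
    others = sum (λ i → c (punchIn j i) * V (punchIn j i) j)
    d∣other : ∀ i → d ℤ∣.∣ c (punchIn j i) * V (punchIn j i) j
    d∣other i = ℤ∣.∣ᵤ⇒∣ (subst₂ _∣_ (sym (ℕP.^-distribˡ-+-* p a (suc e)))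
                                  (sym (ℤP.abs-* (c (punchIn j i)) _))
      (*-pres-∣ (p^a∣c (punchIn j i)) (offDiagonal (punchIn j i) j (punchInᵢ≢i j i))))
    column : c j * g₀ + others ≡ + 0
    column = begin
      c j * g₀ + others          ≡⟨ cong (λ t → c j * t + others) (diagonal j) ⟨
      c j * V j j + others       ≡⟨ sum-remove {i = j} (λ i → c i * V i j) ⟨
      sum (λ i → c i * V i j)    ≡⟨ relation j ⟩
      + 0                        ∎
      where open ≡-Reasoning
    p^[a+1+e]∣cj*g₀ : p ^ (a ℕ.+ suc e) ∣ ∣ c j ∣ ℕ.* ∣ g₀ ∣
    p^[a+1+e]∣cj*g₀ = subst (p ^ (a ℕ.+ suc e) ∣_) (ℤP.abs-* (c j) g₀)
      (ℤ∣.∣⇒∣ᵤ (ℤ∣.∣m+n∣n⇒∣m {m = c j * g₀}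
        (subst (d ℤ∣.∣_) (sym column) (ℤ∣.∣ᵤ⇒∣ (ℕ∣._∣0 _)))
        (∣-sum d _ d∣other)))

  VLt⇒≢0 : ∀ {x y} → VLt p x y → x ≢ + 0
  VLt⇒≢0 {y = y} x<y x≡0 = x<y ∞ (proj₁ (valuation y)) x≡0 (proj₂ (valuation y))

  padicRankBound : ∀ {n k M g₀} (G : Fin M → Vec Bool n → ℤ) (x : Fin M → Vec Bool n) →
    (∀ i → DegreeBelow k (G i)) → g₀ ≢ + 0 → (∀ i → G i (x i) ≡ g₀) →
    (∀ i j → i ≢ j → VLt p g₀ (G i (x j))) → M ≤ dim n k
  padicRankBound {n} {k} {M} {g₀} G x degree g₀≢0 diagonal offDiagonal
    with M ℕP.≤? dim n k | finiteValuation g₀≢0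
  ... | yes M≤dim | _ = M≤dim
  ... | no M≰dim | e , g₀-val =
    contradiction relation (diagonal⇒noRelation {e = e} V g₀-val diagonal p^[1+e]∣offDiagonal c c≢0)
    where
    V : Fin M → Vector ℤ M
    V i j = G i (x j)
    p^[1+e]∣offDiagonal : ∀ i j → i ≢ j → p ^ suc e ∣ ∣ V i j ∣
    p^[1+e]∣offDiagonal i j i≢j = VLt⇒p^[1+e]∣ {e = e} g₀-val (offDiagonal i j i≢j)
    v : Fin M → Coeffs n k
    v i = proj₁ (degree i)
    dependence = integerRelation (ℕP.≰⇒> M≰dim) (coeff ∘ v)
    c = proj₁ dependence
    c≢0 = proj₁ (proj₂ dependence)
    relation : IsRelation V c
    relation j = begin
      sum (λ i → c i * G i (x j))
        ≡⟨ sum-cong-≗ (λ i → cong (c i *_) (proj₂ (degree i) (x j))) ⟨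
      sum (λ i → c i * ⟦ v i ⟧ (x j))
        ≡⟨ ⟦linearCombination⟧ c v (x j) ⟨
      ⟦ linearCombination c v ⟧ (x j)
        ≡⟨ ⟦⟧-cong (linearCombination c v) 0ᶜ (proj₂ (proj₂ dependence)) (x j) ⟩
      ⟦ 0ᶜ {n} {k} ⟧ (x j)
        ≡⟨ ⟦0ᶜ⟧ {n} {k} (x j) ⟩
      + 0 ∎
      where open ≡-Reasoning

leftDifference : ∀ {n} → Subset n → Affine n
leftDifference []      = []
leftDifference (a ∷ A) = (λ b → + Subset.∣ (a ∷ []) ─ (b ∷ []) ∣) ∷ leftDifference A

rightDifference : ∀ {n} → Subset n → Affine n
rightDifference []      = []
rightDifference (a ∷ A) = (λ b → + Subset.∣ (b ∷ []) ─ (a ∷ []) ∣) ∷ rightDifference A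

⟦leftDifference⟧ : ∀ {n} (A x : Subset n) → ⟦ leftDifference A ⟧ₐ x ≡ + Subset.∣ A ─ x ∣
⟦leftDifference⟧ []      []      = refl
⟦leftDifference⟧ (a ∷ A) (b ∷ x) rewrite ⟦leftDifference⟧ A x with a | b
... | true  | true  = refl
... | true  | false = refl
... | false | true  = refl
... | false | false = refl

⟦rightDifference⟧ : ∀ {n} (A x : Subset n) → ⟦ rightDifference A ⟧ₐ x ≡ + Subset.∣ x ─ A ∣
⟦rightDifference⟧ []      []      = refl
⟦rightDifference⟧ (a ∷ A) (b ∷ x) rewrite ⟦rightDifference⟧ A x with a | b
... | true  | true  = refl
... | true  | false = refl
... | false | true  = refl
... | false | false = refl

∣A─A∣≡0 : ∀ {n} (A : Subset n) → Subset.∣ A ─ A ∣ ≡ 0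
∣A─A∣≡0 []          = refl
∣A─A∣≡0 (true  ∷ A) = ∣A─A∣≡0 A
∣A─A∣≡0 (false ∷ A) = ∣A─A∣≡0 A

testForm : ∀ {m} → Subset (suc m) → Affine m
testForm (false ∷ A) = leftDifference A
testForm (true  ∷ A) = rightDifference A

testForm-tail : ∀ {m} (A B : Subset (suc m)) →
  ⟦ testForm A ⟧ₐ (tail B) ≡ + Subset.∣ A ─ B ∣
  ⊎ ⟦ testForm A ⟧ₐ (tail B) ≡ + Subset.∣ B ─ A ∣
testForm-tail (false ∷ A) (true  ∷ B) = inj₁ (⟦leftDifference⟧ A B)
testForm-tail (false ∷ A) (false ∷ B) = inj₁ (⟦leftDifference⟧ A B)
testForm-tail (true  ∷ A) (_     ∷ B) = inj₂ (⟦rightDifference⟧ A B)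

testForm-self : ∀ {m} (A : Subset (suc m)) → ⟦ testForm A ⟧ₐ (tail A) ≡ + 0
testForm-self (false ∷ A) = trans (⟦leftDifference⟧ A A) (cong +_ (∣A─A∣≡0 A))
testForm-self (true  ∷ A) = trans (⟦rightDifference⟧ A A) (cong +_ (∣A─A∣≡0 A))

Unique⇒lookup-injective : ∀ {A : Set} {xs : List A} → Unique xs →
  ∀ {i j} → List.lookup xs i ≡ List.lookup xs j → i ≡ j
Unique⇒lookup-injective (x∉xs ∷ _) {zero}  {zero}  _  = refl
Unique⇒lookup-injective (x∉xs ∷ _) {zero}  {suc j} eq = contradiction eq (All.lookup x∉xs (∈-lookup j))
Unique⇒lookup-injective (x∉xs ∷ _) {suc i} {zero}  eq = contradiction (sym eq) (All.lookup x∉xs (∈-lookup i))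
Unique⇒lookup-injective (_ ∷ uniq) {suc i} {suc j} eq = cong suc (Unique⇒lookup-injective uniq eq)

binomSum≥1 : ∀ n d → 1 ≤ binomSum n d
binomSum≥1 n zero    = ℕP.≤-refl
binomSum≥1 n (suc d) = ℕP.≤-trans (binomSum≥1 n d) (ℕP.m≤m+n _ _)

differencingSperner-bound : ∀ {m q p L d} → Prime p → (F : List (Subset (suc m))) → Unique F →
  DiffSperner (suc m) q L F → (g : Vec ℤ (suc d)) →
  (∀ u → InShift L q u → VLt p (eval g (+ 0)) (eval g u)) → length F ≤ binomSum m d
differencingSperner-bound             _       []          _    _       _ _         = ℕ.z≤n
differencingSperner-bound {m} {d = d} _       (_ ∷ [])    _    _       _ _         = binomSum≥1 m d
differencingSperner-bound {m} {p = p} {d = d} p-prime F@(_ ∷ _ ∷ _) uniq sperner g g₀<g[L] =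
  subst (length F ≤_) (dim≡binomSum m d) (padicRankBound p-prime G x degree g₀≢0 diagonal offDiagonal)
  where
  A = List.lookup F
  G : Fin (length F) → Vec Bool m → ℤ
  G i y = eval g (⟦ testForm (A i) ⟧ₐ y)
  x : Fin (length F) → Vec Bool m
  x j = tail (A j)
  degree : ∀ i → DegreeBelow (suc d) (G i)
  degree i = degreeBelow-polynomial∘affine g (testForm (A i))
  diagonal : ∀ i → G i (x i) ≡ eval g (+ 0)
  diagonal i = cong (eval g) (testForm-self (A i))
  lookup-injective : ∀ {i j} → A i ≡ A j → i ≡ j
  lookup-injective = Unique⇒lookup-injective uniq
  offDiagonal : ∀ i j → i ≢ j → VLt p (eval g (+ 0)) (G i (x j))
  offDiagonal i j i≢j with testForm-tail (A i) (A j)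
  ... | inj₁ eq rewrite eq = g₀<g[L] _ (sperner (∈-lookup i) (∈-lookup j) (i≢j ∘ lookup-injective))
  ... | inj₂ eq rewrite eq = g₀<g[L] _ (sperner (∈-lookup j) (∈-lookup i) (i≢j ∘ sym ∘ lookup-injective))
  g₀≢0 : eval g (+ 0) ≢ + 0
  g₀≢0 = VLt⇒≢0 p-prime (offDiagonal zero (suc zero) λ ())

proposition2p5 : (n q p : ℕ) → 1 ≤ n → IsPrimePowerOf q p →
    (L : List ℕ) → SubsetOfInit L q →
    (F : List (Subset n)) → Unique F → DiffSperner n q L F →
    (d : ℕ) (g : Vec ℤ (suc d)) → HasDegree d g →
    (∀ u → InShift L q u → VLt p (eval g (+ 0)) (eval g u)) →
    (length F ≤ binomSum n d)
    × (((∀ u → InShift L q u → VLe p (eval g (+ 0)) (eval g (u ℤ.- + 1)))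
        ⊎ (∀ u → InShift L q u → VLe p (eval g (+ 0)) (eval g (u ℤ.+ + 1))))
       → length F ≤ binomSum (n ∸ 1) d)
proposition2p5 (suc m) q p _ (p-prime , _) L _ F uniq sperner d g _ g₀<g[L] =
  ℕP.≤-trans bound (binomSum-mono m d) , const bound
  where
  bound : length F ≤ binomSum m d
  bound = differencingSperner-bound {q = q} {L = L} p-prime F uniq sperner g g₀<g[L]
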